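{- Let $H$ be a $k$-uniform $(\tau,\eta)$-sparse hypergraph on $N$ vertices with $m=\gamma\cdot N$ hyperedges. Then the incidence graph $G_H$ is $(\tau',\eta')$-sparse for $\tau'=\frac{\tau}{k\cdot(1+\gamma)}$ and $\eta'=\frac{\eta}{1+\eta}$.
   Context: For a $k$-uniform hypergraph $H$ and $S\subseteq V(H)$, $E(S)$ is the set of hyperedges contained in $S$; $S$ is $\eta$-sparse if $|E(S)|\le\frac{|S|}{k-1-\eta}$, and $H$ is $(\tau,\eta)$-sparse if every $S$ with $|S|\le\tau|V(H)|$ is $\eta$-sparse. For a graph ($k=2$) this reads $|E(S)|\le\frac{|S|}{1-\eta}$. The incidence graph $G_H$ is the bipartite graph with vertex set $V(H)\cup E(H)$ and an edge between $v\in V(H)$ and $e\in E(H)$ whenever $v\in e$. -}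

module Defs where

open import Data.Nat as ℕ using (ℕ; _+_)
open import Data.Integer using (+_)
open import Data.Rational using (ℚ; _/_; _*_; _-_; _≤_)
open import Data.Fin using (Fin; _↑ˡ_; _↑ʳ_)
open import Data.Fin.Subset using (Subset; _∪_; ⁅_⁆; ∣_∣; _∈_)
open import Data.Fin.Subset.Properties using (_⊆?_; _∈?_)
open import Data.List using (List; length; filter; lookup; allFin; concatMap; map)
open import Data.List.Relation.Unary.All using (All)
open import Data.List.Relation.Unary.Unique.Propositional using (Unique)
open import Relation.Binary.PropositionalEquality using (_≡_)

ℕtoℚ : ℕ → ℚ
ℕtoℚ n = + n / 1

record Hypergraph (n : ℕ) : Set where
  field
    edges  : List (Subset n)
    simple : Unique edges

open Hypergraph public

#E : ∀ {n} → Hypergraph n → ℕ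
#E H = length (edges H)

Uniform : ∀ {n} → ℕ → Hypergraph n → Set
Uniform k H = All (λ e → ∣ e ∣ ≡ k) (edges H)

#EIn : ∀ {n} → List (Subset n) → Subset n → ℕ
#EIn es S = length (filter (_⊆? S) es)

-- S is η-sparse (for uniformity k): |E(S)| ≤ |S| / (k - 1 - η),
-- written multiplied out by the (assumed positive) denominator k - 1 - η.
EtaSparseSet : ∀ {n} → ℕ → ℚ → List (Subset n) → Subset n → Set
EtaSparseSet k η es S = ℕtoℚ (#EIn es S) * (ℕtoℚ k - ℕtoℚ 1 - η) ≤ ℕtoℚ ∣ S ∣

TauEtaSparse : ∀ {n} → ℕ → ℚ → ℚ → List (Subset n) → Set
TauEtaSparse {n} k τ η es =
  ∀ (S : Subset n) → ℕtoℚ ∣ S ∣ ≤ τ * ℕtoℚ n → EtaSparseSet k η es S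

-- Incidence graph G_H: vertex set V(H) ⊎ E(H), encoded as Fin (n + m)
-- (first n = vertices of H, last m = hyperedges of H); an edge {v, e}
-- whenever v ∈ e.
incidenceEdges : ∀ {n} (H : Hypergraph n) → List (Subset (n + #E H))
incidenceEdges {n} H =
  concatMap
    (λ v → map (λ i → ⁅ v ↑ˡ #E H ⁆ ∪ ⁅ n ↑ʳ i ⁆)
               (filter (λ i → v ∈? lookup (edges H) i) (allFin (#E H))))
    (allFin n)

IncidenceSparse : ∀ {n} → Hypergraph n → ℚ → ℚ → Set
IncidenceSparse H τ' η' = TauEtaSparse 2 τ' η' (incidenceEdges H)

-- Let S be a vertex set of G_H, A its vertices of H, B its hyperedges, and let the shadow T be A
-- together with every vertex of a hyperedge in B.  Counting vertex by vertex: a vertex of T outside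
-- A lies in some hyperedge of B, and a vertex of A is joined inside S to each hyperedge of B that
-- contains it; as every hyperedge has k vertices, |T| + |E_G(S)| ≤ |A| + k|B|.  In particular
-- |T| ≤ k|S| ≤ τN, so T is η-sparse in H, and since every hyperedge of B lies in T,
-- |B|(k - 1 - η) ≤ |T|.  Hence |E_G(S)| ≤ |A| + (1 + η)|B| ≤ (1 + η)|S|, which is η'-sparseness of S
-- because 1 - η' = 1/(1 + η).

module Submission where

open import Data.Bool.Base using (Bool; true; false; _∧_; _∨_)
open import Data.Bool.Properties using (∨-zeroʳ)
open import Data.Fin.Base using (Fin; zero; suc; _↑ˡ_; _↑ʳ_)
open import Data.Fin.Subset using (Subset; _∈_; _⊆_; _∪_; ⁅_⁆; ∣_∣; inside; outside)
open import Data.Fin.Subset.Properties using (_∈?_; _⊆?_; x∈p∪q⁺; x∈p∪q⁻; x∈⁅x⁆; x∈⁅y⁆⇒x≡y)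
open import Data.List.Base as List using (List; []; _∷_; _++_; map; filter; concatMap; tabulate; allFin; length)
open import Data.List.Membership.Propositional.Properties using (∈-lookup)
open import Data.List.Properties using (tabulate-lookup)
open import Data.List.Relation.Unary.All as All using ()
open import Data.Product.Base using (_,_)
open import Data.Sum.Base using (inj₁; inj₂)
open import Data.Vec.Base as Vec using (_∷_)
open import Data.Vec.Properties using (lookup⇒[]=; lookup∘tabulate)
open import Data.Vec.Functional using (Vector)
open import Function.Base using (_∘_; id)
open import Function.Bundles using (mk⇔)
open import Relation.Binary.PropositionalEquality
  using (_≡_; refl; cong; cong₂; sym; trans; subst; subst₂; module ≡-Reasoning)
open import Relation.Nullary.Decidable using (does; _×-dec_; dec-true; does-⇔)
open import Relation.Unary using (Decidable)

open import Defs

module Counting where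

  open import Data.Nat.Base using (ℕ; zero; suc; _+_; _*_; _≤_; z≤n; s≤s; NonZero)
  open import Data.Nat.Properties
    using ( +-*-semiring; +-assoc; +-identityʳ; *-identityʳ; *-zeroʳ; *-distribˡ-+; +-mono-≤; +-monoˡ-≤
          ; ≤-reflexive; ≤-trans; m≤m+n; m≤n*m; module ≤-Reasoning)
  open import Algebra.Properties.Semiring.Sum +-*-semiring
    using (sum; sum-syntax; ∑-distrib-+; ∑-comm; *-distribˡ-sum; sum-cong-≗; sum-replicate-zero)

  𝟙 : Bool → ℕ
  𝟙 true  = 1
  𝟙 false = 0

  sum-mono-≤ : ∀ {n} {f g : Vector ℕ n} → (∀ i → f i ≤ g i) → sum f ≤ sum g
  sum-mono-≤ {zero}  f≤g = z≤n
  sum-mono-≤ {suc n} f≤g = +-mono-≤ (f≤g zero) (sum-mono-≤ (f≤g ∘ suc))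

  sum-↑ : ∀ m n (f : Vector ℕ (m + n)) →
          sum f ≡ ∑[ i < m ] f (i ↑ˡ n) + ∑[ j < n ] f (m ↑ʳ j)
  sum-↑ zero    n f = refl
  sum-↑ (suc m) n f = trans (cong (f zero +_) (sum-↑ m n (f ∘ suc))) (sym (+-assoc (f zero) _ _))

  anyᵇ : ∀ {n} → Vector Bool n → Bool
  anyᵇ {zero}  f = false
  anyᵇ {suc n} f = f zero ∨ anyᵇ (f ∘ suc)

  anyᵇ-true : ∀ {n} (f : Vector Bool n) i → f i ≡ true → anyᵇ f ≡ true
  anyᵇ-true f zero    fi≡true rewrite fi≡true = refl
  anyᵇ-true f (suc i) fi≡true = trans (cong (f zero ∨_) (anyᵇ-true (f ∘ suc) i fi≡true)) (∨-zeroʳ (f zero))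

  𝟙-anyᵇ≤sum : ∀ {n} (f : Vector Bool n) → 𝟙 (anyᵇ f) ≤ ∑[ i < n ] 𝟙 (f i)
  𝟙-anyᵇ≤sum {zero}  f = z≤n
  𝟙-anyᵇ≤sum {suc n} f with f zero
  ... | true  = s≤s z≤n
  ... | false = 𝟙-anyᵇ≤sum (f ∘ suc)

  𝟙-∨-bound : ∀ x {y} d → 𝟙 y ≤ d → 𝟙 (x ∨ y) + 𝟙 x * d ≤ 𝟙 x + d
  𝟙-∨-bound true  d _   = ≤-reflexive (cong suc (+-identityʳ d))
  𝟙-∨-bound false d y≤d = ≤-trans (≤-reflexive (+-identityʳ _)) y≤d

  covered+inner≤ : ∀ {n m} (a : Vector Bool n) (nbr : Fin n → Vector Bool m) →
    ∑[ v < n ] 𝟙 (a v ∨ anyᵇ (nbr v)) + ∑[ v < n ] (𝟙 (a v) * ∑[ i < m ] 𝟙 (nbr v i))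
      ≤ ∑[ v < n ] 𝟙 (a v) + ∑[ v < n ] ∑[ i < m ] 𝟙 (nbr v i)
  covered+inner≤ {n} {m} a nbr = begin
    ∑[ v < n ] 𝟙 (a v ∨ anyᵇ (nbr v)) + ∑[ v < n ] (𝟙 (a v) * deg v)
      ≡⟨ sym (∑-distrib-+ (λ v → 𝟙 (a v ∨ anyᵇ (nbr v))) (λ v → 𝟙 (a v) * deg v)) ⟩
    ∑[ v < n ] (𝟙 (a v ∨ anyᵇ (nbr v)) + 𝟙 (a v) * deg v)
      ≤⟨ sum-mono-≤ (λ v → 𝟙-∨-bound (a v) (deg v) (𝟙-anyᵇ≤sum (nbr v))) ⟩
    ∑[ v < n ] (𝟙 (a v) + deg v)
      ≡⟨ ∑-distrib-+ (λ v → 𝟙 (a v)) deg ⟩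
    ∑[ v < n ] 𝟙 (a v) + ∑[ v < n ] deg v ∎
    where
    open ≤-Reasoning
    deg : Fin n → ℕ
    deg v = ∑[ i < m ] 𝟙 (nbr v i)

  private variable
    A B : Set

  count : (A → Bool) → List A → ℕ
  count p []       = 0
  count p (x ∷ xs) = 𝟙 (p x) + count p xs

  length-filter≡count : ∀ {P : A → Set} (P? : Decidable P) xs → length (filter P? xs) ≡ count (does ∘ P?) xs
  length-filter≡count P? []       = refl
  length-filter≡count P? (x ∷ xs) with does (P? x)
  ... | true  = cong suc (length-filter≡count P? xs)
  ... | false = length-filter≡count P? xs

  count-filter : ∀ {P : A → Set} (P? : Decidable P) (p : A → Bool) xs →
                 count p (filter P? xs) ≡ count (λ x → does (P? x) ∧ p x) xs
  count-filter P? p []       = refl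
  count-filter P? p (x ∷ xs) with does (P? x)
  ... | true  = cong (𝟙 (p x) +_) (count-filter P? p xs)
  ... | false = count-filter P? p xs

  count-++ : ∀ (p : A → Bool) xs ys → count p (xs ++ ys) ≡ count p xs + count p ys
  count-++ p []       ys = refl
  count-++ p (x ∷ xs) ys = trans (cong (𝟙 (p x) +_) (count-++ p xs ys)) (sym (+-assoc (𝟙 (p x)) _ _))

  count-map : ∀ (p : A → Bool) (f : B → A) xs → count p (map f xs) ≡ count (p ∘ f) xs
  count-map p f []       = refl
  count-map p f (x ∷ xs) = cong (𝟙 (p (f x)) +_) (count-map p f xs)

  count-tabulate : ∀ {n} (p : A → Bool) (f : Fin n → A) → count p (tabulate f) ≡ ∑[ i < n ] 𝟙 (p (f i))
  count-tabulate {n = zero}  p f = refl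
  count-tabulate {n = suc n} p f = cong (𝟙 (p (f zero)) +_) (count-tabulate p (f ∘ suc))

  count-concatMap-tabulate : ∀ {n} (p : A → Bool) (g : B → List A) (f : Fin n → B) →
                             count p (concatMap g (tabulate f)) ≡ ∑[ i < n ] count p (g (f i))
  count-concatMap-tabulate {n = zero}  p g f = refl
  count-concatMap-tabulate {n = suc n} p g f =
    trans (count-++ p (g (f zero)) (concatMap g (tabulate (f ∘ suc))))
          (cong (count p (g (f zero)) +_) (count-concatMap-tabulate p g (f ∘ suc)))

  ∣p∣≡∑ : ∀ {n} (p : Subset n) → ∣ p ∣ ≡ ∑[ i < n ] 𝟙 (does (i ∈? p))
  ∣p∣≡∑ Vec.[]        = refl
  ∣p∣≡∑ (inside  ∷ p) = cong suc (∣p∣≡∑ p)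
  ∣p∣≡∑ (outside ∷ p) = ∣p∣≡∑ p

  ∈?-tabulate : ∀ {n} (f : Vector Bool n) i → does (i ∈? Vec.tabulate f) ≡ f i
  ∈?-tabulate f zero    with f zero
  ... | true  = refl
  ... | false = refl
  ∈?-tabulate f (suc i) = ∈?-tabulate (f ∘ suc) i

  ⊆?-pair : ∀ {n} (x y : Fin n) (p : Subset n) →
            does (⁅ x ⁆ ∪ ⁅ y ⁆ ⊆? p) ≡ does (x ∈? p) ∧ does (y ∈? p)
  ⊆?-pair x y p = does-⇔ (mk⇔ to from) (⁅ x ⁆ ∪ ⁅ y ⁆ ⊆? p) (x ∈? p ×-dec y ∈? p)
    where
    to : ⁅ x ⁆ ∪ ⁅ y ⁆ ⊆ p → _
    to sub = sub (x∈p∪q⁺ (inj₁ (x∈⁅x⁆ x))) , sub (x∈p∪q⁺ (inj₂ (x∈⁅x⁆ y)))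
    from : _ → ⁅ x ⁆ ∪ ⁅ y ⁆ ⊆ p
    from (x∈p , y∈p) z∈ with x∈p∪q⁻ ⁅ x ⁆ ⁅ y ⁆ z∈
    ... | inj₁ z∈⁅x⁆ = subst (_∈ p) (sym (x∈⁅y⁆⇒x≡y x z∈⁅x⁆)) x∈p
    ... | inj₂ z∈⁅y⁆ = subst (_∈ p) (sym (x∈⁅y⁆⇒x≡y y z∈⁅y⁆)) y∈p

  module IncidenceCount {N : ℕ} (H : Hypergraph N) (S : Subset (N + #E H)) where

    m : ℕ
    m = #E H

    edge : Fin m → Subset N
    edge = List.lookup (edges H)

    vertexIn : Fin N → Bool
    vertexIn v = does (v ↑ˡ m ∈? S)

    edgeIn : Fin m → Bool
    edgeIn i = does (N ↑ʳ i ∈? S)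

    incidentIn : Fin N → Vector Bool m
    incidentIn v i = edgeIn i ∧ does (v ∈? edge i)

    covered : Vector Bool N
    covered v = vertexIn v ∨ anyᵇ (incidentIn v)

    shadow : Subset N
    shadow = Vec.tabulate covered

    #vertices : ℕ
    #vertices = ∑[ v < N ] 𝟙 (vertexIn v)

    #hyperedges : ℕ
    #hyperedges = ∑[ i < m ] 𝟙 (edgeIn i)

    ∣S∣≡#vertices+#hyperedges : ∣ S ∣ ≡ #vertices + #hyperedges
    ∣S∣≡#vertices+#hyperedges = trans (∣p∣≡∑ S) (sum-↑ N m _)

    ∣shadow∣≡∑ : ∣ shadow ∣ ≡ ∑[ v < N ] 𝟙 (covered v)
    ∣shadow∣≡∑ = trans (∣p∣≡∑ shadow) (sum-cong-≗ (cong 𝟙 ∘ ∈?-tabulate covered))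

    #EIn-incidence≡ : #EIn (incidenceEdges H) S ≡ ∑[ v < N ] (𝟙 (vertexIn v) * ∑[ i < m ] 𝟙 (incidentIn v i))
    #EIn-incidence≡ = begin
      #EIn (incidenceEdges H) S
        ≡⟨ length-filter≡count (_⊆? S) (incidenceEdges H) ⟩
      count inS (concatMap pairs (allFin N))
        ≡⟨ count-concatMap-tabulate inS pairs id ⟩
      ∑[ v < N ] count inS (pairs v)
        ≡⟨ sum-cong-≗ count-pairs ⟩
      ∑[ v < N ] (𝟙 (vertexIn v) * ∑[ i < m ] 𝟙 (incidentIn v i)) ∎
      where
      open ≡-Reasoning
      inS : Subset (N + m) → Bool
      inS e = does (e ⊆? S)
      pair : Fin N → Fin m → Subset (N + m)
      pair v i = ⁅ v ↑ˡ m ⁆ ∪ ⁅ N ↑ʳ i ⁆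
      edgesAt : Fin N → List (Fin m)
      edgesAt v = filter (λ i → v ∈? edge i) (allFin m)
      pairs : Fin N → List (Subset (N + m))
      pairs v = map (pair v) (edgesAt v)
      𝟙-∧-∧ : ∀ x y z → 𝟙 (x ∧ (y ∧ z)) ≡ 𝟙 y * 𝟙 (z ∧ x)
      𝟙-∧-∧ true  true  true  = refl
      𝟙-∧-∧ true  true  false = refl
      𝟙-∧-∧ true  false _     = refl
      𝟙-∧-∧ false true  true  = refl
      𝟙-∧-∧ false true  false = refl
      𝟙-∧-∧ false false _     = refl
      count-pairs : ∀ v → count inS (pairs v) ≡ 𝟙 (vertexIn v) * ∑[ i < m ] 𝟙 (incidentIn v i)
      count-pairs v = begin
        count inS (pairs v)
          ≡⟨ count-map inS (pair v) (edgesAt v) ⟩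
        count (inS ∘ pair v) (edgesAt v)
          ≡⟨ count-filter (λ i → v ∈? edge i) (inS ∘ pair v) (allFin m) ⟩
        count (λ i → does (v ∈? edge i) ∧ inS (pair v i)) (allFin m)
          ≡⟨ count-tabulate (λ i → does (v ∈? edge i) ∧ inS (pair v i)) id ⟩
        ∑[ i < m ] 𝟙 (does (v ∈? edge i) ∧ inS (pair v i))
          ≡⟨ sum-cong-≗ pair-term ⟩
        ∑[ i < m ] (𝟙 (vertexIn v) * 𝟙 (incidentIn v i))
          ≡⟨ sym (*-distribˡ-sum (𝟙 (vertexIn v)) (𝟙 ∘ incidentIn v)) ⟩
        𝟙 (vertexIn v) * ∑[ i < m ] 𝟙 (incidentIn v i) ∎
        where
        pair-term : ∀ i → 𝟙 (does (v ∈? edge i) ∧ inS (pair v i)) ≡ 𝟙 (vertexIn v) * 𝟙 (incidentIn v i)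
        pair-term i = trans (cong (λ b → 𝟙 (does (v ∈? edge i) ∧ b)) (⊆?-pair (v ↑ˡ m) (N ↑ʳ i) S))
                            (𝟙-∧-∧ (does (v ∈? edge i)) (vertexIn v) (edgeIn i))

    ∑-degrees≡ : ∀ {k} → Uniform k H → ∑[ v < N ] ∑[ i < m ] 𝟙 (incidentIn v i) ≡ k * #hyperedges
    ∑-degrees≡ {k} uniform = begin
      ∑[ v < N ] ∑[ i < m ] 𝟙 (incidentIn v i)
        ≡⟨ ∑-comm (λ v i → 𝟙 (incidentIn v i)) ⟩
      ∑[ i < m ] ∑[ v < N ] 𝟙 (incidentIn v i)
        ≡⟨ sum-cong-≗ degree ⟩
      ∑[ i < m ] (k * 𝟙 (edgeIn i))
        ≡⟨ sym (*-distribˡ-sum k (𝟙 ∘ edgeIn)) ⟩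
      k * #hyperedges ∎
      where
      open ≡-Reasoning
      degree : ∀ i → ∑[ v < N ] 𝟙 (incidentIn v i) ≡ k * 𝟙 (edgeIn i)
      degree i with edgeIn i
      ... | true  = trans (sym (∣p∣≡∑ (edge i))) (trans (All.lookup uniform (∈-lookup i)) (sym (*-identityʳ k)))
      ... | false = trans (sum-replicate-zero N) (sym (*-zeroʳ k))

    ∣shadow∣+#EIn≤ : ∀ {k} → Uniform k H → ∣ shadow ∣ + #EIn (incidenceEdges H) S ≤ #vertices + k * #hyperedges
    ∣shadow∣+#EIn≤ {k} uniform = begin
      ∣ shadow ∣ + #EIn (incidenceEdges H) S
        ≡⟨ cong₂ _+_ ∣shadow∣≡∑ #EIn-incidence≡ ⟩
      ∑[ v < N ] 𝟙 (covered v) + ∑[ v < N ] (𝟙 (vertexIn v) * ∑[ i < m ] 𝟙 (incidentIn v i))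
        ≤⟨ covered+inner≤ vertexIn incidentIn ⟩
      #vertices + ∑[ v < N ] ∑[ i < m ] 𝟙 (incidentIn v i)
        ≡⟨ cong (#vertices +_) (∑-degrees≡ uniform) ⟩
      #vertices + k * #hyperedges ∎
      where open ≤-Reasoning

    edge⊆shadow : ∀ i → edgeIn i ≡ true → edge i ⊆ shadow
    edge⊆shadow i i∈S {v} v∈e = lookup⇒[]= v shadow (trans (lookup∘tabulate covered v) v-covered)
      where
      v-incident : incidentIn v i ≡ true
      v-incident rewrite i∈S = dec-true (v ∈? edge i) v∈e
      v-covered : covered v ≡ true
      v-covered = trans (cong (vertexIn v ∨_) (anyᵇ-true (incidentIn v) i v-incident)) (∨-zeroʳ (vertexIn v))

    #hyperedges≤#EIn-shadow : #hyperedges ≤ #EIn (edges H) shadow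
    #hyperedges≤#EIn-shadow = begin
      #hyperedges
        ≤⟨ sum-mono-≤ edgeIn≤ ⟩
      ∑[ i < m ] 𝟙 (does (edge i ⊆? shadow))
        ≡⟨ sym (count-tabulate (λ e → does (e ⊆? shadow)) edge) ⟩
      count (λ e → does (e ⊆? shadow)) (tabulate edge)
        ≡⟨ cong (count (λ e → does (e ⊆? shadow))) (tabulate-lookup (edges H)) ⟩
      count (λ e → does (e ⊆? shadow)) (edges H)
        ≡⟨ sym (length-filter≡count (_⊆? shadow) (edges H)) ⟩
      #EIn (edges H) shadow ∎
      where
      open ≤-Reasoning
      edgeIn≤ : ∀ i → 𝟙 (edgeIn i) ≤ 𝟙 (does (edge i ⊆? shadow))
      edgeIn≤ i with edgeIn i in i∈S
      ... | false = z≤n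
      ... | true  = ≤-reflexive (cong 𝟙 (sym (dec-true (edge i ⊆? shadow) (edge⊆shadow i i∈S))))

    ∣shadow∣≤k*∣S∣ : ∀ {k} .{{_ : NonZero k}} → Uniform k H → ∣ shadow ∣ ≤ k * ∣ S ∣
    ∣shadow∣≤k*∣S∣ {k} uniform = begin
      ∣ shadow ∣                              ≤⟨ m≤m+n ∣ shadow ∣ _ ⟩
      ∣ shadow ∣ + #EIn (incidenceEdges H) S  ≤⟨ ∣shadow∣+#EIn≤ uniform ⟩
      #vertices + k * #hyperedges             ≤⟨ +-monoˡ-≤ (k * #hyperedges) (m≤n*m #vertices k) ⟩
      k * #vertices + k * #hyperedges         ≡⟨ *-distribˡ-+ k #vertices #hyperedges ⟨
      k * (#vertices + #hyperedges)           ≡⟨ cong (k *_) ∣S∣≡#vertices+#hyperedges ⟨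
      k * ∣ S ∣                               ∎
      where open ≤-Reasoning

module RationalBounds where

  open import Data.Nat.Base as ℕ using (zero; suc)
  open import Data.Nat.Coprimality using (1-coprimeTo)
  import Data.Nat.Coprimality as Coprime
  open import Data.Integer.Base as ℤ using (+_; +≤+)
  import Data.Integer.Properties as ℤ
  open import Data.Rational.Base
  open import Data.Rational.Properties
  open import Data.Rational.Solver using (module +-*-Solver)
  open +-*-Solver using (solve; _:+_; _:*_; _:-_; con; _:=_)

  ℕtoℚ≡mkℚ : ∀ n → ℕtoℚ n ≡ mkℚ (+ n) 0 (Coprime.sym (1-coprimeTo n))
  ℕtoℚ≡mkℚ n = normalize-coprime (Coprime.sym (1-coprimeTo n))

  -- The middle lines are the unfolded sum and product of two fractions with denominator 1.
  ℕtoℚ-+ : ∀ m n → ℕtoℚ (m ℕ.+ n) ≡ ℕtoℚ m + ℕtoℚ n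
  ℕtoℚ-+ m n = begin
    + (m ℕ.+ n) / 1                      ≡⟨ cong (_/ 1) (cong₂ ℤ._+_ (ℤ.*-identityʳ (+ m)) (ℤ.*-identityʳ (+ n))) ⟨
    (+ m ℤ.* + 1 ℤ.+ + n ℤ.* + 1) / 1    ≡⟨ cong₂ _+_ (ℕtoℚ≡mkℚ m) (ℕtoℚ≡mkℚ n) ⟨
    ℕtoℚ m + ℕtoℚ n ∎
    where open ≡-Reasoning

  ℕtoℚ-* : ∀ m n → ℕtoℚ (m ℕ.* n) ≡ ℕtoℚ m * ℕtoℚ n
  ℕtoℚ-* m n = begin
    + (m ℕ.* n) / 1    ≡⟨ cong (_/ 1) (ℤ.pos-* m n) ⟩
    (+ m ℤ.* + n) / 1  ≡⟨ cong₂ _*_ (ℕtoℚ≡mkℚ m) (ℕtoℚ≡mkℚ n) ⟨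
    ℕtoℚ m * ℕtoℚ n ∎
    where open ≡-Reasoning

  ℕtoℚ-mono-≤ : ∀ {m n} → m ℕ.≤ n → ℕtoℚ m ≤ ℕtoℚ n
  ℕtoℚ-mono-≤ {m} {n} m≤n = subst₂ _≤_ (sym (ℕtoℚ≡mkℚ m)) (sym (ℕtoℚ≡mkℚ n))
    (*≤* (ℤ.*-monoʳ-≤-nonNeg (+ 1) (+≤+ m≤n)))

  ℕtoℚ-nonNeg : ∀ n → 0ℚ ≤ ℕtoℚ n
  ℕtoℚ-nonNeg n = ℕtoℚ-mono-≤ {n = n} ℕ.z≤n

  ≤-threshold-rescale : ∀ {k s t n m γ τ τ' : ℚ} → 0ℚ ≤ k → t ≤ k * s → s ≤ τ' * (n + m) →
         γ * n ≡ m → τ' * (k * (1ℚ + γ)) ≡ τ → t ≤ τ * n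
  ≤-threshold-rescale {k} {s} {t} {n} {m} {γ} {τ} {τ'} 0≤k t≤ks s≤τ'[n+m] γn≡m τ'k[1+γ]≡τ = begin
    t                         ≤⟨ t≤ks ⟩
    k * s                     ≤⟨ *-monoˡ-≤-nonNeg k {{nonNegative 0≤k}} s≤τ'[n+m] ⟩
    k * (τ' * (n + m))        ≡⟨ cong (λ m → k * (τ' * (n + m))) γn≡m ⟨
    k * (τ' * (n + γ * n))    ≡⟨ solve 4 (λ k τ' n γ → k :* (τ' :* (n :+ γ :* n)) := τ' :* (k :* (con 1ℚ :+ γ)) :* n) refl k τ' n γ ⟩
    τ' * (k * (1ℚ + γ)) * n   ≡⟨ cong (_* n) τ'k[1+γ]≡τ ⟩
    τ * n                     ∎
    where open ≤-Reasoning

  ≤-[1+η]* : ∀ {a b k t x η s : ℚ} → 0ℚ ≤ a → 0ℚ ≤ η → t + x ≤ a + k * b → b * (k - 1ℚ - η) ≤ t → a + b ≡ s →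
             x ≤ (1ℚ + η) * s
  ≤-[1+η]* {a} {b} {k} {t} {x} {η} {s} 0≤a 0≤η t+x≤a+kb b[k-1-η]≤t a+b≡s = begin
    x                               ≡⟨ solve 2 (λ t x → x := (t :+ x) :- t) refl t x ⟩
    (t + x) - t                     ≤⟨ +-mono-≤ t+x≤a+kb (neg-antimono-≤ b[k-1-η]≤t) ⟩
    (a + k * b) - b * (k - 1ℚ - η)  ≡⟨ solve 4 (λ a b k η → (a :+ k :* b) :- b :* (k :- con 1ℚ :- η) := a :+ b :* (con 1ℚ :+ η)) refl a b k η ⟩
    a + b * (1ℚ + η)                ≤⟨ +-monoˡ-≤ (b * (1ℚ + η)) a≤a+aη ⟩
    a + a * η + b * (1ℚ + η)        ≡⟨ solve 3 (λ a b η → a :+ a :* η :+ b :* (con 1ℚ :+ η) := (con 1ℚ :+ η) :* (a :+ b)) refl a b η ⟩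
    (1ℚ + η) * (a + b)              ≡⟨ cong ((1ℚ + η) *_) a+b≡s ⟩
    (1ℚ + η) * s                    ∎
    where
    open ≤-Reasoning
    a≤a+aη : a ≤ a + a * η
    a≤a+aη = begin
      a       ≡⟨ +-identityʳ a ⟨
      a + 0ℚ  ≤⟨ +-monoʳ-≤ a (nonNegative⁻¹ (a * η) {{nonNeg*nonNeg⇒nonNeg a {{nonNegative 0≤a}} η {{nonNegative 0≤η}}}}) ⟩
      a + a * η ∎

  ≤-[1+η]*⇒η'-sparse : ∀ {x s η η' : ℚ} → 0ℚ ≤ η → η' * (1ℚ + η) ≡ η → x ≤ (1ℚ + η) * s → x * (1ℚ - η') ≤ s
  ≤-[1+η]*⇒η'-sparse {x} {s} {η} {η'} 0≤η η'[1+η]≡η x≤[1+η]s = *-cancelʳ-≤-pos (1ℚ + η) (begin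
    x * (1ℚ - η') * (1ℚ + η)              ≡⟨ solve 3 (λ x η' η → x :* (con 1ℚ :- η') :* (con 1ℚ :+ η) := x :* (con 1ℚ :+ η) :- x :* (η' :* (con 1ℚ :+ η))) refl x η' η ⟩
    x * (1ℚ + η) - x * (η' * (1ℚ + η))    ≡⟨ cong (λ e → x * (1ℚ + η) - x * e) η'[1+η]≡η ⟩
    x * (1ℚ + η) - x * η                  ≡⟨ solve 2 (λ x η → x :* (con 1ℚ :+ η) :- x :* η := x) refl x η ⟩
    x                                     ≤⟨ x≤[1+η]s ⟩
    (1ℚ + η) * s                          ≡⟨ *-comm (1ℚ + η) s ⟩
    s * (1ℚ + η)                          ∎)
    where
    open ≤-Reasoning
    instance
      1+η-positive : Positive (1ℚ + η)
      1+η-positive = pos+nonNeg⇒pos 1ℚ η {{nonNegative 0≤η}}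

  η<k-1⇒k≢0 : ∀ {k η} → 0ℚ ≤ η → η < ℕtoℚ k - 1ℚ → ℕ.NonZero k
  η<k-1⇒k≢0 {zero}  0≤η η<-1 with *<* () ← ≤-<-trans 0≤η η<-1
  η<k-1⇒k≢0 {suc k} _   _    = _

  p≤q⇒0≤q-p : ∀ {p q} → p ≤ q → 0ℚ ≤ q - p
  p≤q⇒0≤q-p {p} {q} p≤q = begin
    0ℚ     ≡⟨ +-inverseʳ p ⟨
    p - p  ≤⟨ +-monoˡ-≤ (- p) p≤q ⟩
    q - p  ∎
    where open ≤-Reasoning

open import Data.Nat.Base using (ℕ; NonZero)
open import Data.Rational.Base using (ℚ; 0ℚ; _*_; _+_; _-_; _≤_; _<_; nonNegative)
open import Data.Rational.Properties using (≤-trans; <⇒≤; *-monoʳ-≤-nonNeg)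
open Counting using (module IncidenceCount)
open RationalBounds

mainTheorem10 : (k N : ℕ) → .{{_ : NonZero N}} → (H : Hypergraph N) →
    Uniform k H →
    (τ η γ τ' η' : ℚ) →
    0ℚ ≤ η → η < ℕtoℚ k - ℕtoℚ 1 →
    TauEtaSparse k τ η (edges H) →
    γ * ℕtoℚ N ≡ ℕtoℚ (#E H) →
    τ' * (ℕtoℚ k * (ℕtoℚ 1 + γ)) ≡ τ →
    η' * (ℕtoℚ 1 + η) ≡ η →
    IncidenceSparse H τ' η'
mainTheorem10 k N H uniform τ η γ τ' η' 0≤η η<k-1 sparse γN≡m τ'k[1+γ]≡τ η'[1+η]≡η S ∣S∣≤τ'[N+m] =
  ≤-[1+η]*⇒η'-sparse {η' = η'} 0≤η η'[1+η]≡η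
    (≤-[1+η]* {k = ℕtoℚ k} (ℕtoℚ-nonNeg #vertices) 0≤η shadow+incidences≤ hyperedges-sparse ∣S∣≡)
  where
  open IncidenceCount H S

  instance
    k≢0 : NonZero k
    k≢0 = η<k-1⇒k≢0 0≤η η<k-1

  ∣S∣≡ : ℕtoℚ #vertices + ℕtoℚ #hyperedges ≡ ℕtoℚ ∣ S ∣
  ∣S∣≡ = trans (sym (ℕtoℚ-+ #vertices #hyperedges)) (cong ℕtoℚ (sym ∣S∣≡#vertices+#hyperedges))

  shadow+incidences≤ : ℕtoℚ ∣ shadow ∣ + ℕtoℚ (#EIn (incidenceEdges H) S) ≤ ℕtoℚ #vertices + ℕtoℚ k * ℕtoℚ #hyperedges
  shadow+incidences≤ =
    subst₂ _≤_ (ℕtoℚ-+ ∣ shadow ∣ _) (trans (ℕtoℚ-+ #vertices _) (cong (ℕtoℚ #vertices +_) (ℕtoℚ-* k #hyperedges)))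
           (ℕtoℚ-mono-≤ (∣shadow∣+#EIn≤ uniform))

  ∣shadow∣≤τN : ℕtoℚ ∣ shadow ∣ ≤ τ * ℕtoℚ N
  ∣shadow∣≤τN = ≤-threshold-rescale {γ = γ} {τ' = τ'} (ℕtoℚ-nonNeg k)
    (subst (ℕtoℚ ∣ shadow ∣ ≤_) (ℕtoℚ-* k ∣ S ∣) (ℕtoℚ-mono-≤ (∣shadow∣≤k*∣S∣ uniform)))
    (subst (λ n → ℕtoℚ ∣ S ∣ ≤ τ' * n) (ℕtoℚ-+ N (#E H)) ∣S∣≤τ'[N+m]) γN≡m τ'k[1+γ]≡τ

  hyperedges-sparse : ℕtoℚ #hyperedges * (ℕtoℚ k - ℕtoℚ 1 - η) ≤ ℕtoℚ ∣ shadow ∣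
  hyperedges-sparse = ≤-trans
    (*-monoʳ-≤-nonNeg _ {{nonNegative (p≤q⇒0≤q-p (<⇒≤ η<k-1))}} (ℕtoℚ-mono-≤ #hyperedges≤#EIn-shadow))
    (sparse shadow ∣shadow∣≤τN)
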